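{- Let $x_1,\dots,x_n$ and $y_1,\dots,y_n$ be two non-increasing sequences of integers such that $|x_n-x_1|\le1$ and $|y_n-y_1|\le1$. If $\sum_{i=1}^n x_i\le\sum_{i=1}^n y_i-2n$, then $x_i\le y_i-2$ for all $1\le i\le n$. -}

module Defs where

open import Data.Nat using (ℕ; suc)
open import Data.Fin using (Fin; zero; fromℕ) renaming (_≤_ to _≤ᶠ_)
open import Data.Integer using (ℤ; _≤_; _-_; ∣_∣)
open import Data.Vec.Functional using (Vector; foldr)
import Data.Integer as ℤ

-- non-increasing sequence indexed by Fin n (index 0 ↔ x_1)
NonIncreasing : ∀ {n} → (Fin n → ℤ) → Set
NonIncreasing {n} x = ∀ (i j : Fin n) → i ≤ᶠ j → x j ≤ x i

sumℤ : ∀ {n} → (Fin n → ℤ) → ℤ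
sumℤ = foldr ℤ._+_ (ℤ.+ 0)

-- Each sequence takes at most two adjacent values, so x i ≤ 1 + x j and y i ≤ 1 + y j
-- for all i, j. If x i ≥ y i - 1 held at a single index i, comparing with i on either
-- side (monotonicity of y for j ≥ i, of x for j ≤ i) gives x j ≥ y j - 2 for every j,
-- strictly at i; summing yields Σ x > Σ y - 2n.
module Submission where

open import Defs
open import Data.Nat using (ℕ; suc) renaming (_≤_ to _≤ℕ_)
open import Data.Fin using (Fin; zero; fromℕ)
import Data.Nat as ℕ
open import Data.Integer using (ℤ; _≤_; _<_; _≤?_; _+_; _-_; _*_; -_; ∣_∣; +_; -[1+_]; -≤+; +≤+)
  renaming (suc to sucℤ; pred to predℤ)
open import Data.Integer.Properties
open import Data.Integer.Tactic.RingSolver using (solve-∀)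
import Data.Fin as F
import Data.Fin.Properties as FP
open import Data.Sum using (inj₁; inj₂)
open import Relation.Nullary using (yes; no; contradiction)
open import Relation.Binary.PropositionalEquality using (_≡_; subst; cong; module ≡-Reasoning)

sumℤ-mono-≤ : ∀ {n} {f g : Fin n → ℤ} → (∀ j → f j ≤ g j) → sumℤ f ≤ sumℤ g
sumℤ-mono-≤ {ℕ.zero} f≤g = ≤-refl
sumℤ-mono-≤ {suc n}  f≤g = +-mono-≤ (f≤g zero) (sumℤ-mono-≤ (λ j → f≤g (F.suc j)))

sumℤ-mono-< : ∀ {n} {f g : Fin n → ℤ} → (∀ j → f j ≤ g j) → (i : Fin n) → f i < g i →
              sumℤ f < sumℤ g
sumℤ-mono-< f≤g zero      fi<gi = +-mono-<-≤ fi<gi (sumℤ-mono-≤ (λ j → f≤g (F.suc j)))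
sumℤ-mono-< f≤g (F.suc i) fi<gi =
  +-mono-≤-< (f≤g zero) (sumℤ-mono-< (λ j → f≤g (F.suc j)) i fi<gi)

sumℤ-sub-const : ∀ n (y : Fin n → ℤ) c → sumℤ (λ j → y j - c) ≡ sumℤ y - c * + n
sumℤ-sub-const ℕ.zero  y c = base c
  where
  base : ∀ c → + 0 ≡ + 0 - c * + 0
  base = solve-∀
sumℤ-sub-const (suc n) y c = begin
  (y zero - c) + sumℤ (λ j → y (F.suc j) - c)         ≡⟨ cong (λ s → (y zero - c) + s) (sumℤ-sub-const n _ c) ⟩
  (y zero - c) + (sumℤ (λ j → y (F.suc j)) - c * + n) ≡⟨ step (y zero) _ c (+ n) ⟩
  sumℤ y - c * + suc n                                ∎
  where
  open ≡-Reasoning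
  step : ∀ a b c k → (a - c) + (b - c * k) ≡ (a + b) - c * (+ 1 + k)
  step = solve-∀

i≤+∣i∣ : ∀ i → i ≤ + ∣ i ∣
i≤+∣i∣ (+ n)    = ≤-refl
i≤+∣i∣ -[1+ n ] = -≤+

∣i-j∣≤k⇒j≤k+i : ∀ {i j k} → ∣ i - j ∣ ≤ℕ k → j ≤ + k + i
∣i-j∣≤k⇒j≤k+i {i} {j} {k} ∣i-j∣≤k = begin
  j             ≡⟨ j≡[j-i]+i i j ⟩
  (j - i) + i   ≤⟨ +-monoˡ-≤ i (≤-trans (i≤+∣i∣ (j - i)) (+≤+ j-i≤k)) ⟩
  + k + i       ∎
  where
  open ≤-Reasoning
  j≡[j-i]+i : ∀ i j → j ≡ (j - i) + i
  j≡[j-i]+i = solve-∀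
  j-i≤k : ∣ j - i ∣ ≤ℕ k
  j-i≤k = subst (_≤ℕ k) (∣i-j∣≡∣j-i∣ i j) ∣i-j∣≤k

nonIncreasing-≤suc : ∀ {m} {x : Fin (suc m) → ℤ} → NonIncreasing x →
                     ∣ x (fromℕ m) - x zero ∣ ≤ℕ 1 → ∀ i j → x i ≤ sucℤ (x j)
nonIncreasing-≤suc {m} {x} anti spread i j = begin
  x i                ≤⟨ anti zero i ℕ.z≤n ⟩
  x zero             ≤⟨ ∣i-j∣≤k⇒j≤k+i {x (fromℕ m)} spread ⟩
  sucℤ (x (fromℕ m)) ≤⟨ suc-mono (anti j (fromℕ m) (FP.≤fromℕ j)) ⟩
  sucℤ (x j)         ∎
  where open ≤-Reasoning

<-at⇒≤-everywhere : ∀ {m} {x y : Fin (suc m) → ℤ} → NonIncreasing x → NonIncreasing y →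
                    ∣ x (fromℕ m) - x zero ∣ ≤ℕ 1 → ∣ y (fromℕ m) - y zero ∣ ≤ℕ 1 →
                    ∀ c i → y i - c < x i → ∀ j → y j - c ≤ x j
<-at⇒≤-everywhere {x = x} {y} antiˣ antiʸ spreadˣ spreadʸ c i yᵢ-c<xᵢ j with FP.≤-total i j
... | inj₁ i≤j = begin
  y j - c                ≤⟨ +-monoˡ-≤ (- c) (antiʸ i j i≤j) ⟩
  y i - c                ≤⟨ i<j⇒i≤pred[j] yᵢ-c<xᵢ ⟩
  predℤ (x i)            ≤⟨ pred-mono (nonIncreasing-≤suc antiˣ spreadˣ i j) ⟩
  predℤ (sucℤ (x j))     ≡⟨ pred-suc (x j) ⟩
  x j                    ∎
  where open ≤-Reasoning
... | inj₂ j≤i = begin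
  y j - c                ≤⟨ +-monoˡ-≤ (- c) (nonIncreasing-≤suc antiʸ spreadʸ j i) ⟩
  sucℤ (y i) - c         ≡⟨ +-assoc (+ 1) (y i) (- c) ⟩
  sucℤ (y i - c)         ≤⟨ i<j⇒suc[i]≤j yᵢ-c<xᵢ ⟩
  x i                    ≤⟨ antiˣ j i j≤i ⟩
  x j                    ∎
  where open ≤-Reasoning

lemma5p1 : (m : ℕ) (x y : Fin (suc m) → ℤ) →
    NonIncreasing x → NonIncreasing y →
    ∣ x (fromℕ m) - x zero ∣ ≤ℕ 1 →
    ∣ y (fromℕ m) - y zero ∣ ≤ℕ 1 →
    sumℤ x ≤ sumℤ y - (+ 2) * (+ suc m) →
    ∀ (i : Fin (suc m)) → x i ≤ y i - + 2
lemma5p1 m x y antiˣ antiʸ spreadˣ spreadʸ Σx≤Σy-2n i with x i ≤? y i - + 2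
... | yes xᵢ≤yᵢ-2 = xᵢ≤yᵢ-2
... | no  xᵢ≰yᵢ-2 = contradiction Σx≤Σy-2n (<⇒≱ Σy-2n<Σx)
  where
  yᵢ-2<xᵢ : y i - + 2 < x i
  yᵢ-2<xᵢ = ≰⇒> xᵢ≰yᵢ-2
  Σy-2n<Σx : sumℤ y - + 2 * + suc m < sumℤ x
  Σy-2n<Σx = subst (_< sumℤ x) (sumℤ-sub-const (suc m) y (+ 2))
    (sumℤ-mono-< (<-at⇒≤-everywhere antiˣ antiʸ spreadˣ spreadʸ (+ 2) i yᵢ-2<xᵢ) i yᵢ-2<xᵢ)
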